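{- Let $\mathbf s$ be an epistandard word with directive word $\Delta=x_1x_2x_3\cdots$ ($x_i\in\mathcal A$), and let $m$ be the smallest positive integer such that $\mathrm{Alph}(x_1x_2\cdots x_m)=\mathrm{Alph}(\mathbf s)$. Then, for all $n\ge m$, $Pal(x_1\cdots x_n)$ is a quasiperiod of $\mathbf s$.
   Context: $\mathcal A$ is a finite alphabet; $\mathrm{Alph}(u)$ is the set of letters of $u$. $Pal$ is the iterated palindromic closure: $Pal(\varepsilon)=\varepsilon$, and for a word $w$ and letter $x$, $Pal(wx)$ is the shortest palindrome having $Pal(w)x$ as a prefix. An infinite word $\mathbf s$ is epistandard (standard episturmian) iff there is an infinite word $\Delta=x_1x_2\cdots$ over $\mathcal A$ with $\mathbf s=\lim_{n\to\infty}Pal(x_1\cdots x_n)$; this $\Delta$ is unique and called the directive word of $\mathbf s$. A finite word $u$ is a quasiperiod of an infinite word $\mathbf w$ if there are words $p_n$ ($n\ge0$) with $p_0=\varepsilon$, $|p_n|<|p_{n+1}|\le|p_nu|$ and $p_nu$ a prefix of $\mathbf w$ for all $n$. -}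

module Defs where

open import Data.Nat using (ℕ; zero; suc; _+_; _≤_; _<_)
open import Data.List using (List; []; _∷_; _++_; [_]; length; reverse; lookup)
open import Data.List.Membership.Propositional using (_∈_)
open import Data.Fin using (fromℕ<)
open import Data.Product using (Σ; ∃; _×_)
open import Relation.Binary.PropositionalEquality using (_≡_)
open import Relation.Nullary using (¬_)
open import Function.Bundles using (_⇔_)

-- Infinite words over A are functions ℕ → A (letter at position i, 0-based).

IsPrefixOf : {A : Set} → List A → (ℕ → A) → Set
IsPrefixOf v w = (i : ℕ) (h : i < length v) → lookup v (fromℕ< h) ≡ w i

IsPrefix : {A : Set} → List A → List A → Set
IsPrefix {A} u v = Σ (List A) λ t → u ++ t ≡ v

Palindrome : {A : Set} → List A → Set
Palindrome p = reverse p ≡ p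

IsShortestPalWithPrefix : {A : Set} → List A → List A → Set
IsShortestPalWithPrefix {A} u q =
  Palindrome q × IsPrefix u q ×
  ((r : List A) → Palindrome r → IsPrefix u r → length q ≤ length r)

-- P n = Pal(x₁ ⋯ xₙ) where Δ = x₁ x₂ ⋯ with x_{i+1} = Δ i:
-- Pal(ε) = ε and Pal(wx) = shortest palindrome with prefix Pal(w)x.
IsPalSeq : {A : Set} → (ℕ → A) → (ℕ → List A) → Set
IsPalSeq Δ P = (P 0 ≡ []) × ((n : ℕ) → IsShortestPalWithPrefix (P n ++ [ Δ n ]) (P (suc n)))

IsLimit : {A : Set} → (ℕ → List A) → (ℕ → A) → Set
IsLimit P s = (i : ℕ) → ∃ λ N → (n : ℕ) → N ≤ n →
  Σ (i < length (P n)) λ h → lookup (P n) (fromℕ< h) ≡ s i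

IsEpistandardWithDirective : {A : Set} → (ℕ → A) → (ℕ → A) → Set
IsEpistandardWithDirective {A} s Δ =
  Σ (ℕ → List A) λ P → IsPalSeq Δ P × IsLimit P s

prefix : {A : Set} → (ℕ → A) → ℕ → List A
prefix Δ zero = []
prefix Δ (suc n) = prefix Δ n ++ [ Δ n ]

InAlph∞ : {A : Set} → A → (ℕ → A) → Set
InAlph∞ a w = ∃ λ i → w i ≡ a

SameAlph : {A : Set} → List A → (ℕ → A) → Set
SameAlph {A} u w = (a : A) → (a ∈ u) ⇔ InAlph∞ a w

IsQuasiperiod : {A : Set} → List A → (ℕ → A) → Set
IsQuasiperiod {A} u w =
  Σ (ℕ → List A) λ p →
    (p 0 ≡ []) ×
    ((n : ℕ) → length (p n) < length (p (suc n))
             × length (p (suc n)) ≤ length (p n) + length u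
             × IsPrefixOf (p n ++ u) w)

-- Write P N = Pal(x₁ ⋯ x_N) and u = P n.  Each P N is a prefix of s, and s at position |P N| is
-- x_{N+1}.  For N ≥ m that letter already occurs among x₁ ⋯ x_m, say as x_{k+1} with k < N; then
-- P N = P k x_{k+1} t and the palindrome t̃ x_{k+1} P k x_{k+1} t extends P N x_{N+1}, so
-- |P (N+1)| ≤ 2 |P N|.  Hence P (N+1) = b · P N with |b| ≤ |P N|: P (N+1) is covered by two
-- overlapping copies of P N.  By induction on N, consecutive occurrences of u in P N lie at distance
-- at most |u|, and these occurrences, read off in s, form the quasiperiod sequence.
module Submission where

open import Defs
open import Data.Nat using (ℕ; zero; suc; _+_; _≤_; _<_; z≤n; s≤s; _<?_; _≤′_; ≤′-refl; ≤′-step)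
open import Data.Nat.Properties
open import Data.List using (List; []; _∷_; _++_; [_]; length; reverse; lookup; take; drop)
open import Data.List.Properties
  using (length-++; length-++-≤ˡ; length-++-≤ʳ; length-++-sucʳ; length-reverse; length-take;
         ++-assoc; ++-identityʳ;
         ∷-injective; ∷-injectiveʳ; reverse-++; reverse-involutive; unfold-reverse; take++drop≡id)
open import Data.List.Membership.Propositional using (_∈_)
open import Data.List.Membership.Propositional.Properties using (∈-++⁻)
open import Data.List.Relation.Unary.Any using (here)
open import Data.Fin using (fromℕ<)
open import Data.Product using (∃; ∃₂; _×_; _,_; proj₁; proj₂)
open import Data.Sum using (inj₁; inj₂)
open import Data.Empty using (⊥-elim)
open import Function using (_∘_)
open import Function.Bundles using (Equivalence)
open import Relation.Nullary using (yes; no; ¬_)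
open import Relation.Binary.PropositionalEquality hiding ([_])

module _ {A : Set} where

  ++-injectiveˡ : (xs zs : List A) {ys ws : List A} →
    length xs ≡ length zs → xs ++ ys ≡ zs ++ ws → xs ≡ zs
  ++-injectiveˡ []       []       _   _ = refl
  ++-injectiveˡ (x ∷ xs) (z ∷ zs) len e =
    cong₂ _∷_ (proj₁ (∷-injective e)) (++-injectiveˡ xs zs (suc-injective len) (∷-injectiveʳ e))

  reverse-++-∷ : (p : List A) (x : A) (t : List A) → reverse (p ++ x ∷ t) ≡ reverse t ++ x ∷ reverse p
  reverse-++-∷ p x t = begin
    reverse (p ++ x ∷ t)              ≡⟨ reverse-++ p (x ∷ t) ⟩
    reverse (x ∷ t) ++ reverse p      ≡⟨ cong (_++ reverse p) (unfold-reverse x t) ⟩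
    (reverse t ++ [ x ]) ++ reverse p ≡⟨ ++-assoc (reverse t) [ x ] (reverse p) ⟩
    reverse t ++ x ∷ reverse p        ∎
    where open ≡-Reasoning

  isPrefix-refl : (u : List A) → IsPrefix u u
  isPrefix-refl u = [] , ++-identityʳ u

  isPrefix-trans : {u v w : List A} → IsPrefix u v → IsPrefix v w → IsPrefix u w
  isPrefix-trans {u} (t , refl) (t′ , refl) = t ++ t′ , sym (++-assoc u t t′)

  isPrefix-length : {u v : List A} → IsPrefix u v → length u ≤ length v
  isPrefix-length {u} (t , refl) = length-++-≤ˡ u

  lookup-isPrefix : {u v : List A} {i : ℕ} → IsPrefix u v → (h : i < length u) (h′ : i < length v) →
    lookup v (fromℕ< h′) ≡ lookup u (fromℕ< h)
  lookup-isPrefix {x ∷ u} {i = zero}  (t , refl) _       _        = refl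
  lookup-isPrefix {x ∷ u} {i = suc i} (t , refl) (s≤s h) (s≤s h′) = lookup-isPrefix {u} (t , refl) h h′

  lookup-++-∷ : (u : List A) (x : A) (t : List A) (h : length u < length (u ++ x ∷ t)) →
    lookup (u ++ x ∷ t) (fromℕ< h) ≡ x
  lookup-++-∷ []      x t _       = refl
  lookup-++-∷ (y ∷ u) x t (s≤s h) = lookup-++-∷ u x t h

  isPrefixOf-trans : {u v : List A} {w : ℕ → A} → IsPrefix u v → IsPrefixOf v w → IsPrefixOf u w
  isPrefixOf-trans u⊑v v⊑w i h = trans (sym (lookup-isPrefix u⊑v h h′)) (v⊑w i h′)
    where h′ = <-≤-trans h (isPrefix-length u⊑v)

  isPrefixOf-letter : (u : List A) (x : A) (t : List A) {w : ℕ → A} →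
    IsPrefixOf (u ++ x ∷ t) w → w (length u) ≡ x
  isPrefixOf-letter u x t u·x·t⊑w = trans (sym (u·x·t⊑w (length u) h)) (lookup-++-∷ u x t h)
    where h = subst (length u <_) (sym (length-++-sucʳ u x t)) (s≤s (length-++-≤ˡ u))

  ∈-prefix⁻ : (Δ : ℕ → A) (m : ℕ) {x : A} → x ∈ prefix Δ m → ∃ λ k → k < m × Δ k ≡ x
  ∈-prefix⁻ Δ (suc m) x∈ with ∈-++⁻ (prefix Δ m) x∈
  ... | inj₁ x∈′ = let k , k<m , e = ∈-prefix⁻ Δ m x∈′ in k , m<n⇒m<1+n k<m , e
  ... | inj₂ (here refl) = m , n<1+n m , refl

  palindrome-++-reverse : (w : List A) → Palindrome (w ++ reverse w)
  palindrome-++-reverse w =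
    trans (reverse-++ w (reverse w)) (cong (_++ reverse w) (reverse-involutive w))

  reverse-suffix : (w a : List A) → Palindrome (w ++ a) → length a ≤ length w →
    reverse a ≡ take (length a) w
  reverse-suffix w a pal |a|≤|w| = ++-injectiveˡ (reverse a) (take (length a) w) lengths (begin
    reverse a ++ reverse w                      ≡⟨ reverse-++ w a ⟨
    reverse (w ++ a)                            ≡⟨ pal ⟩
    w ++ a                                      ≡⟨ cong (_++ a) (take++drop≡id (length a) w) ⟨
    (take (length a) w ++ drop (length a) w) ++ a ≡⟨ ++-assoc (take (length a) w) _ a ⟩
    take (length a) w ++ drop (length a) w ++ a ∎)
    where
    open ≡-Reasoning
    lengths = trans (length-reverse a) (sym (trans (length-take (length a) w) (m≤n⇒m⊓n≡m |a|≤|w|)))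

  palindrome-extension-unique : (w a a′ : List A) → Palindrome (w ++ a) → Palindrome (w ++ a′) →
    length a ≡ length a′ → length a ≤ length w → a ≡ a′
  palindrome-extension-unique w a a′ pal pal′ |a|≡|a′| |a|≤|w| = begin
    a                              ≡⟨ reverse-involutive a ⟨
    reverse (reverse a)            ≡⟨ cong reverse (reverse-suffix w a pal |a|≤|w|) ⟩
    reverse (take (length a) w)    ≡⟨ cong (λ k → reverse (take k w)) |a|≡|a′| ⟩
    reverse (take (length a′) w)   ≡⟨ cong reverse (reverse-suffix w a′ pal′ |a′|≤|w|) ⟨
    reverse (reverse a′)           ≡⟨ reverse-involutive a′ ⟩
    a′                             ∎
    where
    open ≡-Reasoning
    |a′|≤|w| = subst (_≤ length w) |a|≡|a′| |a|≤|w|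

  shortestPal-length≤ : {w q : List A} → IsShortestPalWithPrefix w q → length q ≤ length w + length w
  shortestPal-length≤ {w} (_ , _ , shortest) =
    ≤-trans (shortest (w ++ reverse w) (palindrome-++-reverse w) (reverse w , refl))
            (≤-reflexive (trans (length-++ w) (cong (length w +_) (length-reverse w))))

  shortestPal-unique : {w q q′ : List A} →
    IsShortestPalWithPrefix w q → IsShortestPalWithPrefix w q′ → q ≡ q′
  shortestPal-unique {w} sp@(pal , (a , refl) , shortest) (pal′ , (a′ , refl) , shortest′) =
    cong (w ++_) (palindrome-extension-unique w a a′ pal pal′ |a|≡|a′| |a|≤|w|)
    where
    |a|≡|a′| : length a ≡ length a′
    |a|≡|a′| = +-cancelˡ-≡ (length w) _ _ (begin
      length w + length a  ≡⟨ length-++ w ⟨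
      length (w ++ a)      ≡⟨ ≤-antisym (shortest _ pal′ (a′ , refl)) (shortest′ _ pal (a , refl)) ⟩
      length (w ++ a′)     ≡⟨ length-++ w ⟩
      length w + length a′ ∎)
      where open ≡-Reasoning
    |a|≤|w| : length a ≤ length w
    |a|≤|w| = +-cancelˡ-≤ (length w) _ _
                (subst (_≤ length w + length w) (length-++ w) (shortestPal-length≤ sp))

  palindrome-sandwich : (p : List A) (x : A) (t : List A) → Palindrome p →
    Palindrome ((reverse t ++ x ∷ p) ++ x ∷ t)
  palindrome-sandwich p x t pal = begin
    reverse ((reverse t ++ x ∷ p) ++ x ∷ t)        ≡⟨ reverse-++-∷ (reverse t ++ x ∷ p) x t ⟩
    reverse t ++ x ∷ reverse (reverse t ++ x ∷ p)
      ≡⟨ cong (λ v → reverse t ++ x ∷ v) (reverse-++-∷ (reverse t) x p) ⟩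
    reverse t ++ x ∷ reverse p ++ x ∷ reverse (reverse t)
      ≡⟨ cong₂ (λ v v′ → reverse t ++ x ∷ v ++ x ∷ v′) pal (reverse-involutive t) ⟩
    reverse t ++ x ∷ p ++ x ∷ t                    ≡⟨ ++-assoc (reverse t) (x ∷ p) (x ∷ t) ⟨
    (reverse t ++ x ∷ p) ++ x ∷ t                  ∎
    where open ≡-Reasoning

  -- A palindrome w = p x t with p a palindrome is also t̃ x p, so the palindrome t̃ x p x t extends w x.
  shortestPal-repeat-length≤ : {p t w q : List A} {x : A} → Palindrome p → Palindrome w →
    p ++ x ∷ t ≡ w → IsShortestPalWithPrefix (w ++ [ x ]) q → length q ≤ length w + length w
  shortestPal-repeat-length≤ {p} {t} {x = x} pal-p pal-w refl (_ , _ , shortest) =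
    ≤-trans (shortest _ (palindrome-sandwich p x t pal-p) (t , extends)) bound
    where
    w = p ++ x ∷ t
    mirror : w ≡ reverse t ++ x ∷ p
    mirror = trans (sym pal-w) (trans (reverse-++-∷ p x t) (cong (λ v → reverse t ++ x ∷ v) pal-p))
    extends : (w ++ [ x ]) ++ t ≡ (reverse t ++ x ∷ p) ++ x ∷ t
    extends = trans (++-assoc w [ x ] t) (cong (_++ x ∷ t) mirror)
    bound : length ((reverse t ++ x ∷ p) ++ x ∷ t) ≤ length w + length w
    bound = begin
      length ((reverse t ++ x ∷ p) ++ x ∷ t)        ≡⟨ length-++ (reverse t ++ x ∷ p) ⟩
      length (reverse t ++ x ∷ p) + length (x ∷ t)  ≡⟨ cong (λ v → length v + length (x ∷ t)) mirror ⟨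
      length w + length (x ∷ t)                     ≤⟨ +-monoʳ-≤ (length w) (length-++-≤ʳ (x ∷ t) {p}) ⟩
      length w + length w                           ∎
      where open ≤-Reasoning

  OccursAt : List A → List A → ℕ → Set
  OccursAt u w q = ∃₂ λ (x y : List A) → length x ≡ q × x ++ u ++ y ≡ w

  NextOccurrence : List A → List A → ℕ → Set
  NextOccurrence u w q = ∃ λ q′ → q < q′ × q′ ≤ q + length u × OccursAt u w q′

  -- The finite form of quasiperiodicity.
  Covers : List A → List A → Set
  Covers u w = ∀ q → q + length u < length w → NextOccurrence u w q

  occursAt-isPrefix : {u w : List A} → IsPrefix u w → OccursAt u w 0
  occursAt-isPrefix (t , u·t≡w) = [] , t , refl , u·t≡w

  occursAt-++ˡ : (b : List A) {u w : List A} {q : ℕ} → OccursAt u w q → OccursAt u (b ++ w) (length b + q)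
  occursAt-++ˡ b (x , y , refl , refl) = b ++ x , y , length-++ b , ++-assoc b x _

  occursAt-++ʳ : {u w : List A} (t : List A) {q : ℕ} → OccursAt u w q → OccursAt u (w ++ t) q
  occursAt-++ʳ {u} t (x , y , |x| , refl) = x , y ++ t , |x| , (begin
    x ++ u ++ y ++ t     ≡⟨ cong (x ++_) (++-assoc u y t) ⟨
    x ++ (u ++ y) ++ t   ≡⟨ ++-assoc x (u ++ y) t ⟨
    (x ++ u ++ y) ++ t   ∎)
    where open ≡-Reasoning

  nextOccurrence-++ˡ : (b : List A) {u w : List A} {q : ℕ} →
    NextOccurrence u w q → NextOccurrence u (b ++ w) (length b + q)
  nextOccurrence-++ˡ b {u} {q = q} (q′ , q<q′ , q′≤q+U , occ) =
    length b + q′ , +-monoʳ-< (length b) q<q′ ,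
    subst (length b + q′ ≤_) (sym (+-assoc (length b) q (length u))) (+-monoʳ-≤ (length b) q′≤q+U) ,
    occursAt-++ˡ b occ

  nextOccurrence-++ʳ : {u w : List A} (t : List A) {q : ℕ} → NextOccurrence u w q → NextOccurrence u (w ++ t) q
  nextOccurrence-++ʳ t (q′ , q<q′ , q′≤q+U , occ) = q′ , q<q′ , q′≤q+U , occursAt-++ʳ t occ

  covers-self : (u : List A) → Covers u u
  covers-self u q q+U<U = ⊥-elim (<-irrefl refl (≤-<-trans (m≤n+m (length u) q) q+U<U))

  -- If Q = L a = b L with |b| ≤ |L|, occurrences of u in the two copies of L leave no gap in Q.
  covers-overlap : {u L Q a b : List A} → Covers u L → IsPrefix u L →
    L ++ a ≡ Q → b ++ L ≡ Q → length b ≤ length L → Covers u Q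
  covers-overlap {u} {L} {a = a} {b} cov u⊑L refl b·L≡Q |b|≤|L| q q+U<Q with q <? length b
  ... | yes q<B with q + length u <? length L
  ...   | yes q+U<L = nextOccurrence-++ʳ a (cov q q+U<L)
  ...   | no  q+U≮L = subst (λ v → NextOccurrence u v q) b·L≡Q
            (length b , q<B , ≤-trans |b|≤|L| (≮⇒≥ q+U≮L) ,
             subst (OccursAt u (b ++ L)) (+-identityʳ (length b)) (occursAt-++ˡ b (occursAt-isPrefix u⊑L)))
  covers-overlap {u} {L} {a = a} {b} cov u⊑L refl b·L≡Q |b|≤|L| q q+U<Q | no q≮B
    with m≤n⇒∃[o]m+o≡n (≮⇒≥ q≮B)
  ... | r , refl =
    subst (λ v → NextOccurrence u v (length b + r)) b·L≡Q (nextOccurrence-++ˡ b (cov r r+U<L))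
    where
    r+U<L : r + length u < length L
    r+U<L = +-cancelˡ-< (length b) _ _ (subst₂ _<_ (+-assoc (length b) r (length u))
              (trans (cong length (sym b·L≡Q)) (length-++ b)) q+U<Q)

  NextOccurrence∞ : List A → (ℕ → A) → ℕ → Set
  NextOccurrence∞ u s q = ∃ λ (x : List A) → q < length x × length x ≤ q + length u × IsPrefixOf (x ++ u) s

  nextOccurrence⇒∞ : {u w : List A} {s : ℕ → A} {q : ℕ} →
    IsPrefixOf w s → NextOccurrence u w q → NextOccurrence∞ u s q
  nextOccurrence⇒∞ {u} w⊑s (_ , q<q′ , q′≤q+U , x , y , refl , x·u·y≡w) =
    x , q<q′ , q′≤q+U , isPrefixOf-trans (y , trans (++-assoc x u y) x·u·y≡w) w⊑s

  isQuasiperiod-from-gaps : {u : List A} {s : ℕ → A} →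
    IsPrefixOf u s → (∀ q → NextOccurrence∞ u s q) → IsQuasiperiod u s
  isQuasiperiod-from-gaps {u} {s} u⊑s next = p , refl , λ j →
    let _ , |pj|<|x| , |x|≤|pj|+U , _ = next (length (p j)) in |pj|<|x| , |x|≤|pj|+U , occurrence j
    where
    p : ℕ → List A
    p zero    = []
    p (suc j) = proj₁ (next (length (p j)))
    occurrence : ∀ j → IsPrefixOf (p j ++ u) s
    occurrence zero    = u⊑s
    occurrence (suc j) = let _ , _ , _ , x·u⊑s = next (length (p j)) in x·u⊑s

RecurrentFrom : {A : Set} → (ℕ → A) → ℕ → Set
RecurrentFrom Δ n = ∀ N → n ≤ N → ∃ λ k → k < N × Δ k ≡ Δ N

module PalSeq {A : Set} {Δ : ℕ → A} {P : ℕ → List A} (ps : IsPalSeq Δ P) where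

  palindrome : ∀ N → Palindrome (P N)
  palindrome zero    = subst Palindrome (sym (proj₁ ps)) refl
  palindrome (suc N) = proj₁ (proj₂ ps N)

  extension : ∀ N → ∃ λ t → P N ++ Δ N ∷ t ≡ P (suc N)
  extension N = let t , e = proj₁ (proj₂ (proj₂ ps N)) in
    t , trans (sym (++-assoc (P N) [ Δ N ] t)) e

  isPrefix-mono : ∀ {M N} → M ≤ N → IsPrefix (P M) (P N)
  isPrefix-mono = go ∘ ≤⇒≤′
    where
    go : ∀ {M N} → M ≤′ N → IsPrefix (P M) (P N)
    go ≤′-refl     = isPrefix-refl _
    go (≤′-step h) = isPrefix-trans (go h) (let t , e = extension _ in Δ _ ∷ t , e)

  length-< : ∀ N → length (P N) < length (P (suc N))
  length-< N = let t , e = extension N in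
    subst (length (P N) <_) (trans (sym (length-++-sucʳ (P N) (Δ N) t)) (cong length e))
          (s≤s (length-++-≤ˡ (P N)))

  length-≥ : ∀ N → N ≤ length (P N)
  length-≥ zero    = z≤n
  length-≥ (suc N) = ≤-<-trans (length-≥ N) (length-< N)

  suffix : ∀ N → ∃ λ b → b ++ P N ≡ P (suc N)
  suffix N = let t , e = extension N in reverse t ++ [ Δ N ] , (begin
    (reverse t ++ [ Δ N ]) ++ P N        ≡⟨ ++-assoc (reverse t) [ Δ N ] (P N) ⟩
    reverse t ++ Δ N ∷ P N               ≡⟨ cong (λ v → reverse t ++ Δ N ∷ v) (palindrome N) ⟨
    reverse t ++ Δ N ∷ reverse (P N)     ≡⟨ reverse-++-∷ (P N) (Δ N) t ⟨
    reverse (P N ++ Δ N ∷ t)             ≡⟨ cong reverse e ⟩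
    reverse (P (suc N))                  ≡⟨ palindrome (suc N) ⟩
    P (suc N)                            ∎)
    where open ≡-Reasoning

  length-suc≤ : ∀ {k N} → k < N → Δ k ≡ Δ N → length (P (suc N)) ≤ length (P N) + length (P N)
  length-suc≤ {k} {N} k<N Δk≡ΔN =
    shortestPal-repeat-length≤ (palindrome k) (palindrome N) P[N]-split
      (subst (λ x → IsShortestPalWithPrefix (P N ++ [ x ]) (P (suc N))) (sym Δk≡ΔN) (proj₂ ps N))
    where
    P[N]-split : P k ++ Δ k ∷ (proj₁ (extension k) ++ proj₁ (isPrefix-mono k<N)) ≡ P N
    P[N]-split = let t , e = extension k ; t′ , e′ = isPrefix-mono k<N in
      trans (sym (++-assoc (P k) (Δ k ∷ t) t′)) (trans (cong (_++ t′) e) e′)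

  border : ∀ {k N} → k < N → Δ k ≡ Δ N → ∃ λ b → b ++ P N ≡ P (suc N) × length b ≤ length (P N)
  border {N = N} k<N Δk≡ΔN = let b , e = suffix N in b , e ,
    +-cancelʳ-≤ _ _ _ (subst (_≤ length (P N) + length (P N)) (trans (sym (cong length e)) (length-++ b))
                             (length-suc≤ k<N Δk≡ΔN))

  covers : ∀ n → RecurrentFrom Δ n → ∀ j → Covers (P n) (P (j + n))
  covers n recurrent zero    = covers-self (P n)
  covers n recurrent (suc j) =
    let k , k<N , Δk≡ΔN = recurrent (j + n) (m≤n+m n j)
        b , b·P≡P′ , |b|≤|P| = border k<N Δk≡ΔN
        t , e = extension (j + n)
    in covers-overlap (covers n recurrent j) (isPrefix-mono (m≤n+m n j)) e b·P≡P′ |b|≤|P|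

  isPrefixOf-limit : {s : ℕ → A} → IsLimit P s → ∀ N → IsPrefixOf (P N) s
  isPrefixOf-limit lim N i i<|P| =
    let N₀ , converges = lim i ; i<|P′| , e = converges (N₀ + N) (m≤m+n N₀ N)
    in trans (sym (lookup-isPrefix (isPrefix-mono (m≤n+m N N₀)) i<|P| i<|P′|)) e

  letter-at-length : {s : ℕ → A} → ∀ N → IsPrefixOf (P (suc N)) s → s (length (P N)) ≡ Δ N
  letter-at-length {s} N P⊑s = let t , e = extension N in
    isPrefixOf-letter (P N) (Δ N) t (subst (λ v → IsPrefixOf v s) (sym e) P⊑s)

palSeq-unique : {A : Set} {Δ : ℕ → A} {P P′ : ℕ → List A} →
  IsPalSeq Δ P → IsPalSeq Δ P′ → ∀ N → P N ≡ P′ N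
palSeq-unique ps ps′ zero    = trans (proj₁ ps) (sym (proj₁ ps′))
palSeq-unique {Δ = Δ} {P′ = P′} ps ps′ (suc N) =
  shortestPal-unique (proj₂ ps N)
    (subst (λ v → IsShortestPalWithPrefix (v ++ [ Δ N ]) (P′ (suc N))) (sym (palSeq-unique ps ps′ N))
           (proj₂ ps′ N))

theorem4p10 : {A : Set} → (enum : List A) → ((a : A) → a ∈ enum) →
    (s Δ : ℕ → A) → IsEpistandardWithDirective s Δ →
    (m : ℕ) → 1 ≤ m → SameAlph (prefix Δ m) s →
    ((k : ℕ) → 1 ≤ k → k < m → ¬ SameAlph (prefix Δ k) s) →
    (n : ℕ) → m ≤ n →
    (P : ℕ → List A) → IsPalSeq Δ P → IsQuasiperiod (P n) s
theorem4p10 _ _ s Δ (P′ , ps′ , lim) m _ sameAlph _ n m≤n P ps =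
  isQuasiperiod-from-gaps (P⊑s n) window
  where
  open PalSeq ps

  P⊑s : ∀ N → IsPrefixOf (P N) s
  P⊑s N = subst (λ v → IsPrefixOf v s) (sym (palSeq-unique ps ps′ N))
                (PalSeq.isPrefixOf-limit ps′ lim N)

  recurrent : RecurrentFrom Δ n
  recurrent N n≤N =
    let ΔN∈s = length (P N) , letter-at-length N (P⊑s (suc N))
        k , k<m , Δk≡ΔN = ∈-prefix⁻ Δ m (Equivalence.from (sameAlph (Δ N)) ΔN∈s)
    in k , <-≤-trans k<m (≤-trans m≤n n≤N) , Δk≡ΔN

  window : ∀ q → NextOccurrence∞ (P n) s q
  window q = nextOccurrence⇒∞ (P⊑s (j + n)) (covers n recurrent j q q+U<|P|)
    where
    j = suc (q + length (P n))
    q+U<|P| = ≤-trans (m≤m+n j n) (length-≥ (j + n))
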